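{- For every bidirected graph $D$, the DP-chromatic number of $D$ equals the DP-chromatic number of its underlying undirected graph $G(D)$.
   Context: Digraphs are finite, without loops and parallel arcs, but opposite arcs are allowed. A bidirected graph is obtained from a simple undirected graph by replacing each edge by two opposite arcs; $G(D)$ is the simple graph on $V(D)$ with $u,v$ adjacent iff $uv$ or $vu$ is an arc. A cover of a digraph $D$ is a pair $(X,H)$ where the sets $X_v$ ($v\in V(D)$) are pairwise disjoint, $H$ is a digraph on $\bigcup_v X_v$ with each $X_v$ independent, for each arc $uv\in A(D)$ the arcs of $H$ from $X_u$ to $X_v$ form a (possibly empty) matching, and every arc of $H$ arises this way. An acyclic transversal is a set $T$ meeting each $X_v$ in exactly one vertex with $H[T]$ containing no directed cycle. $D$ is DP-$k$-colorable if every cover with $|X_v|\ge k$ for all $v$ has an acyclic transversal; the DP-chromatic number $\chi_{DP}(D)$ is the least $k\ge 0$ such that $D$ is DP-$k$-colorable. For an undirected simple graph $G$ the notions are the same with $H$ undirected, matchings undirected, and "acyclic transversal" replaced by "transversal $T$ with $H[T]$ edgeless". -}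

module Defs where

open import Data.Nat using (ℕ; zero; suc; _≤_)
open import Data.Fin using (Fin; zero; suc; inject₁; fromℕ)
open import Data.Bool using (Bool; true; false; T; _∨_)
open import Data.Product using (Σ; ∃; _×_; _,_)
open import Relation.Binary.PropositionalEquality using (_≡_)
open import Relation.Nullary using (¬_)
open import Function.Definitions using (Injective)
open import Function.Bundles using (_⇔_)

-- Finite digraphs on vertex set Fin n: no loops, no parallel arcs
-- (an arc relation), opposite arcs allowed.

record Digraph (n : ℕ) : Set where
  field
    arc      : Fin n → Fin n → Bool
    loopless : ∀ v → arc v v ≡ false
open Digraph public

record Graph (n : ℕ) : Set where
  field
    adj   : Fin n → Fin n → Bool
    irrefl : ∀ v → adj v v ≡ false
    sym    : ∀ u v → adj u v ≡ adj v u
open Graph public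

IsBidirected : ∀ {n} → Digraph n → Set
IsBidirected {n} D = Σ (Graph n) λ G → ∀ u v → arc D u v ≡ adj G u v

underlying : ∀ {n} → Digraph n → Graph n
underlying {n} D = record
  { adj = λ u v → arc D u v ∨ arc D v u
  ; irrefl = irr
  ; sym = λ u v → ∨-comm' (arc D u v) (arc D v u)
  }
  where
  ∨-comm' : ∀ a b → (a ∨ b) ≡ (b ∨ a)
  ∨-comm' false false = _≡_.refl
  ∨-comm' false true  = _≡_.refl
  ∨-comm' true  false = _≡_.refl
  ∨-comm' true  true  = _≡_.refl
  irr : ∀ v → (arc D v v ∨ arc D v v) ≡ false
  irr v with arc D v v | loopless D v
  ... | false | _ = _≡_.refl

HasDirectedCycle : ∀ {V : Set} → (V → V → Set) → Set
HasDirectedCycle {V} R =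
  Σ ℕ λ k → Σ (Fin (suc k) → V) λ c →
    Injective _≡_ _≡_ c ×
    (∀ (i : Fin k) → R (c (inject₁ i)) (c (suc i))) ×
    R (c (fromℕ k)) (c zero)

-- Covers of digraphs.  X_v is represented as Fin (size v), so the sets
-- X_v are automatically pairwise disjoint (the vertex set of H is the
-- disjoint union Σ v, Fin (size v)).

record DiCover {n : ℕ} (D : Digraph n) : Set where
  field
    size : Fin n → ℕ
    harc : (u : Fin n) → Fin (size u) → (v : Fin n) → Fin (size v) → Bool
    indep : ∀ v i j → harc v i v j ≡ false
    arises : ∀ u i v j → T (harc u i v j) → T (arc D u v)
    match-tail : ∀ u i v j j' → T (harc u i v j) → T (harc u i v j') → j ≡ j'
    match-head : ∀ u i i' v j → T (harc u i v j) → T (harc u i' v j) → i ≡ i'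
open DiCover public

IsAcyclicTransversal : ∀ {n} {D : Digraph n} (C : DiCover D) →
                       ((v : Fin n) → Fin (size C v)) → Set
IsAcyclicTransversal C t =
  ¬ HasDirectedCycle (λ u v → T (harc C u (t u) v (t v)))

DiDPColorable : ∀ {n} → Digraph n → ℕ → Set
DiDPColorable {n} D k =
  (C : DiCover D) → (∀ v → k ≤ size C v) →
  Σ ((v : Fin n) → Fin (size C v)) λ t → IsAcyclicTransversal C t

IsDiDPChromaticNumber : ∀ {n} → Digraph n → ℕ → Set
IsDiDPChromaticNumber D k =
  DiDPColorable D k × (∀ j → DiDPColorable D j → k ≤ j)

record Cover {n : ℕ} (G : Graph n) : Set where
  field
    size : Fin n → ℕ
    hedge : (u : Fin n) → Fin (size u) → (v : Fin n) → Fin (size v) → Bool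
    hsym  : ∀ u i v j → hedge u i v j ≡ hedge v j u i
    indep : ∀ v i j → hedge v i v j ≡ false
    arises : ∀ u i v j → T (hedge u i v j) → T (adj G u v)
    match : ∀ u i v j j' → T (hedge u i v j) → T (hedge u i v j') → j ≡ j'
open Cover public

IsIndependentTransversal : ∀ {n} {G : Graph n} (C : Cover G) →
                           ((v : Fin n) → Fin (Cover.size C v)) → Set
IsIndependentTransversal C t =
  ∀ u v → ¬ T (hedge C u (t u) v (t v))

DPColorable : ∀ {n} → Graph n → ℕ → Set
DPColorable {n} G k =
  (C : Cover G) → (∀ v → k ≤ Cover.size C v) →
  Σ ((v : Fin n) → Fin (Cover.size C v)) λ t → IsIndependentTransversal C t

IsDPChromaticNumber : ∀ {n} → Graph n → ℕ → Set
IsDPChromaticNumber G k =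
  DPColorable G k × (∀ j → DPColorable G j → k ≤ j)

module Submission where

-- For a bidirected digraph D, DP-colourability of D and of its underlying
-- graph G(D) coincide for every number of colours k; since both
-- DP-chromatic numbers are "the least k with DP-k-colourability", they are
-- then equal (least-cong).  The two directions of the colourability
-- equivalence are:
--
--  * G(D) ⇒ D holds for every digraph D.  Orient-and-forget: from a cover
--    of D keep only the arcs of H going from a vertex of smaller index
--    to one of larger index, as undirected edges.  In an independent transversal of it every
--    remaining arc of H[T] strictly decreases the vertex index, so H[T]
--    has no directed cycle (descending⇒acyclic).
--
--  * D ⇒ G(D) uses bidirectedness: a cover of G(D) is itself a cover of D
--    with symmetric arcs (directed-cover), and an edge of H[T] would be a
--    directed 2-cycle (two-cycle), so an acyclic transversal is independent.

open import Defs
open import Data.Nat using (ℕ; zero; suc; _≤_; _<_; _<ᵇ_)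
open import Data.Nat.Properties
  using (≤-refl; ≤-trans; <⇒≤; <-≤-trans; <-irrefl; <-asym; <-cmp; <ᵇ⇒<; <⇒<ᵇ)
open import Data.Fin using (Fin; zero; suc; toℕ; inject₁; fromℕ)
open import Data.Fin.Properties using (toℕ-injective)
open import Data.Bool using (Bool; true; false; T; _∨_; _∧_)
open import Data.Bool.Properties using (∨-comm; T-∨; T-∧)
open import Data.Empty using (⊥-elim)
open import Data.Product using (_×_; _,_)
open import Data.Sum using (_⊎_; inj₁; inj₂)
open import Relation.Binary.Definitions using (tri<; tri≈; tri>)
open import Relation.Binary.PropositionalEquality
  using (_≡_; _≢_; refl; trans; subst) renaming (sym to ≡-sym)
open import Relation.Nullary using (¬_)
open import Function.Bundles using (_⇔_; mk⇔; Equivalence)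

open Equivalence using (to; from)

¬T⇒≡false : ∀ {b} → ¬ T b → b ≡ false
¬T⇒≡false {false} _  = refl
¬T⇒≡false {true}  ¬t = ⊥-elim (¬t _)

descending-path : ∀ {V : Set} (R : V → V → Set) (f : V → ℕ) →
  (∀ {a b} → R a b → f b < f a) →
  ∀ k (c : Fin (suc k) → V) → (∀ (i : Fin k) → R (c (inject₁ i)) (c (suc i))) →
  f (c (fromℕ k)) ≤ f (c zero)
descending-path R f desc zero    c steps = ≤-refl
descending-path R f desc (suc k) c steps =
  ≤-trans (descending-path R f desc k (λ i → c (suc i)) (λ i → steps (suc i)))
          (<⇒≤ (desc (steps zero)))

-- A relation strictly decreasing a natural-number potential is acyclic:
-- the closing arc c k → c 0 would give f (c 0) < f (c k) ≤ f (c 0).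
descending⇒acyclic : ∀ {V : Set} (R : V → V → Set) (f : V → ℕ) →
  (∀ {a b} → R a b → f b < f a) → ¬ HasDirectedCycle R
descending⇒acyclic R f desc (k , c , _ , steps , closing) =
  <-irrefl refl (<-≤-trans (desc closing) (descending-path R f desc k c steps))

two-cycle : ∀ {V : Set} (R : V → V → Set) {u v : V} →
  u ≢ v → R u v → R v u → HasDirectedCycle R
two-cycle {V} R {u} {v} u≢v uv vu = 1 , c , c-injective , steps , vu
  where
  c : Fin 2 → V
  c zero       = u
  c (suc zero) = v
  c-injective : ∀ {x y} → c x ≡ c y → x ≡ y
  c-injective {zero}     {zero}     _ = refl
  c-injective {zero}     {suc zero} e = ⊥-elim (u≢v e)
  c-injective {suc zero} {zero}     e = ⊥-elim (u≢v (≡-sym e))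
  c-injective {suc zero} {suc zero} _ = refl
  steps : ∀ (i : Fin 1) → R (c (inject₁ i)) (c (suc i))
  steps zero = uv

least-cong : ∀ {P Q : ℕ → Set} → (∀ j → P j ⇔ Q j) → ∀ k →
  (P k × (∀ j → P j → k ≤ j)) ⇔ (Q k × (∀ j → Q j → k ≤ j))
least-cong P⇔Q k = mk⇔
  (λ (pk , least) → to (P⇔Q k) pk , λ j qj → least j (from (P⇔Q j) qj))
  (λ (qk , least) → from (P⇔Q k) qk , λ j pj → least j (to (P⇔Q j) pj))

module FromUnderlying {n : ℕ} {D : Digraph n} (C : DiCover D) where

  X : Fin n → ℕ
  X = DiCover.size C

  h : (u : Fin n) → Fin (X u) → (v : Fin n) → Fin (X v) → Bool
  h = DiCover.harc C

  oriented : (u : Fin n) → Fin (X u) → (v : Fin n) → Fin (X v) → Bool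
  oriented u i v j = ((toℕ u <ᵇ toℕ v) ∧ h u i v j) ∨ ((toℕ v <ᵇ toℕ u) ∧ h v j u i)

  oriented-cases : ∀ u i v j → T (oriented u i v j) →
    (toℕ u < toℕ v × T (h u i v j)) ⊎ (toℕ v < toℕ u × T (h v j u i))
  oriented-cases u i v j e with to T-∨ e
  ... | inj₁ p = let (lt , a) = to T-∧ p in inj₁ (<ᵇ⇒< (toℕ u) (toℕ v) lt , a)
  ... | inj₂ p = let (lt , a) = to T-∧ p in inj₂ (<ᵇ⇒< (toℕ v) (toℕ u) lt , a)

  oriented-from-arc : ∀ {u i v j} → toℕ u < toℕ v → T (h u i v j) → T (oriented u i v j)
  oriented-from-arc lt a = from T-∨ (inj₁ (from T-∧ (<⇒<ᵇ lt , a)))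

  -- The matching property: two edges at (u , i) towards X_v come from arcs
  -- of the same direction, which form a matching in the cover of D.
  oriented-match : ∀ u i v j j' → T (oriented u i v j) → T (oriented u i v j') → j ≡ j'
  oriented-match u i v j j' e e' with oriented-cases u i v j e | oriented-cases u i v j' e'
  ... | inj₁ (_ , a)  | inj₁ (_ , a')  = DiCover.match-tail C u i v j j' a a'
  ... | inj₂ (_ , a)  | inj₂ (_ , a')  = DiCover.match-head C v j j' u i a a'
  ... | inj₁ (lt , _) | inj₂ (gt , _)  = ⊥-elim (<-asym lt gt)
  ... | inj₂ (gt , _) | inj₁ (lt , _)  = ⊥-elim (<-asym lt gt)

  oriented-irrefl : ∀ v i j → ¬ T (oriented v i v j)
  oriented-irrefl v i j e with oriented-cases v i v j e
  ... | inj₁ (lt , _) = <-irrefl refl lt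
  ... | inj₂ (lt , _) = <-irrefl refl lt

  oriented-arises : ∀ u i v j → T (oriented u i v j) → T (adj (underlying D) u v)
  oriented-arises u i v j e with oriented-cases u i v j e
  ... | inj₁ (_ , a) = from T-∨ (inj₁ (DiCover.arises C u i v j a))
  ... | inj₂ (_ , a) = from T-∨ (inj₂ (DiCover.arises C v j u i a))

  undirected-cover : Cover (underlying D)
  undirected-cover = record
    { size   = X
    ; hedge  = oriented
    ; hsym   = λ u i v j → ∨-comm ((toℕ u <ᵇ toℕ v) ∧ h u i v j) ((toℕ v <ᵇ toℕ u) ∧ h v j u i)
    ; indep  = λ v i j → ¬T⇒≡false (oriented-irrefl v i j)
    ; arises = oriented-arises
    ; match  = oriented-match
    }

  -- In an independent transversal of the undirected cover every arc of
  -- H[T] goes from a larger to a smaller index: an increasing arc would be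
  -- a kept edge, and an arc inside one X_v is excluded by independence.
  transversal-descends : (t : (v : Fin n) → Fin (X v)) →
    IsIndependentTransversal undirected-cover t →
    ∀ {u v} → T (h u (t u) v (t v)) → toℕ v < toℕ u
  transversal-descends t independent {u} {v} a with <-cmp (toℕ u) (toℕ v)
  ... | tri< lt _ _ = ⊥-elim (independent u v (oriented-from-arc lt a))
  ... | tri> _ _ gt = gt
  ... | tri≈ _ eq _ with toℕ-injective eq
  ...   | refl = ⊥-elim (subst T (DiCover.indep C u (t u) (t u)) a)

underlying⇒digraph : ∀ {n} (D : Digraph n) k → DPColorable (underlying D) k → DiDPColorable D k
underlying⇒digraph D k colourable C large
  with colourable (FromUnderlying.undirected-cover C) large
... | t , independent =
  t , descending⇒acyclic _ toℕ (FromUnderlying.transversal-descends C t independent)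

module ToUnderlying {n : ℕ} {D : Digraph n} (bidirected : IsBidirected D) where

  arc-sym : ∀ u v → arc D u v ≡ arc D v u
  arc-sym u v = let (G , D≡G) = bidirected in
    trans (D≡G u v) (trans (Graph.sym G u v) (≡-sym (D≡G v u)))

  adj⇒arc : ∀ {u v} → T (adj (underlying D) u v) → T (arc D u v)
  adj⇒arc {u} {v} e with to T-∨ e
  ... | inj₁ a = a
  ... | inj₂ a = subst T (arc-sym v u) a

  directed-cover : Cover (underlying D) → DiCover D
  directed-cover C = record
    { size       = Cover.size C
    ; harc       = hedge C
    ; indep      = Cover.indep C
    ; arises     = λ u i v j e → adj⇒arc (Cover.arises C u i v j e)
    ; match-tail = Cover.match C
    ; match-head = λ u i i' v j e e' →
        Cover.match C v j u i i' (subst T (hsym C u i v j) e) (subst T (hsym C u i' v j) e')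
    }

  -- An edge of H[T] joins distinct vertices of D and yields a directed
  -- 2-cycle, so acyclic transversals of the directed cover are independent.
  acyclic⇒independent : (C : Cover (underlying D)) (t : (v : Fin n) → Fin (Cover.size C v)) →
    IsAcyclicTransversal (directed-cover C) t → IsIndependentTransversal C t
  acyclic⇒independent C t acyclic u v e =
    acyclic (two-cycle _ u≢v e (subst T (hsym C u (t u) v (t v)) e))
    where
    u≢v : u ≢ v
    u≢v refl = subst T (Cover.indep C u (t u) (t u)) e

digraph⇒underlying : ∀ {n} {D : Digraph n} → IsBidirected D →
  ∀ k → DiDPColorable D k → DPColorable (underlying D) k
digraph⇒underlying bidirected k colourable C large
  with colourable (ToUnderlying.directed-cover bidirected C) large
... | t , acyclic = t , ToUnderlying.acyclic⇒independent bidirected C t acyclic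

corollary4 : ∀ (n : ℕ) (D : Digraph n) → IsBidirected D →
    ∀ (k : ℕ) → IsDiDPChromaticNumber D k ⇔ IsDPChromaticNumber (underlying D) k
corollary4 n D bidirected = least-cong colourable⇔
  where
  colourable⇔ : ∀ j → DiDPColorable D j ⇔ DPColorable (underlying D) j
  colourable⇔ j = mk⇔ (digraph⇒underlying bidirected j) (underlying⇒digraph D j)
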